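{- Fix a positive integer $K$, and let $f_1,\dots,f_K$ be the functions defined in the context. For every $t\in\{1,\dots,K\}$: (1) $f_t$ is monotone non-decreasing in each of $r_{K-t+1},\dots,r_K$ and in each of $b_{K-t+1},\dots,b_K$; (2) the maximum of $f_t$ is $m_t=(2t-1)!$, attained when $r_{K-t+1}=\dots=r_K=1$; (3) the minimum of $f_t$ is $0$, attained when $r_{K-t+1}=\dots=r_K=b_{K-t+1}=\dots=b_K=0$.
   Context: Let $m_t=(2t-1)!$. For $t\in\{1,\dots,K\}$, $f_t$ is a function of $r_{K-t+1},\dots,r_K\in\{0,1\}$ and non-negative integers $b_{K-t+1},\dots,b_K$, written $f_t(r_{K-t+1},\dots,r_K;b_{K-t+1},\dots,b_K)$. Put $\hat b_i=\min\{b_i,2(K-i)\}$; each $f_t$ depends on the $b_i$ only through $\hat b_i$. Define $f_1(r_K;b_K)=r_K$. For $t\ge2$, given the arguments, let $\delta_{t-1}=m_{t-1}-f_{t-1}(r_{K-t+2},\dots,r_K;\hat b_{K-t+2},\dots,\hat b_K)$, $d_t=2(t-1)-\hat b_{K-t+1}$, $s_t=1-r_{K-t+1}$, $a_t=2m_{t-1}s_t+\delta_{t-1}(d_t-1)$, and $f_t(r_{K-t+1},\dots,r_K;b_{K-t+1},\dots,b_K)=m_t-a_t d_t$. -}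

module Defs where

open import Data.Nat using (ℕ; zero; suc; _∸_; _⊓_; _!) renaming (_*_ to _*ℕ_; _+_ to _+ℕ_)

open import Data.Fin using (Fin; toℕ)
open import Data.Vec using (Vec; []; _∷_)
open import Data.Integer using (ℤ; +_; _-_; _*_; _+_)

-- m t = (2t-1)!  (as an integer; only used for t ≥ 1)
m : ℕ → ℤ
m t = + (((2 *ℕ t) ∸ 1) !)

-- Capped value  b̂ = min b (2(t-1)), where for the head argument b_{K-t+1} of f_t
-- the cap 2(K-(K-t+1)) equals 2(t-1).
--
-- f t rs bs  represents  f_t(r_{K-t+1},…,r_K ; b_{K-t+1},…,b_K), where
--   rs = r_{K-t+1} ∷ … ∷ r_K   (r_i ∈ {0,1} as Fin 2)
--   bs = b_{K-t+1} ∷ … ∷ b_K   (b_i ∈ ℕ)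
-- The value f 0 [] [] = 0 is a dummy (f_t is only defined for t ≥ 1).
f : (t : ℕ) → Vec (Fin 2) t → Vec ℕ t → ℤ
f zero [] [] = + 0
f (suc zero) (r ∷ []) (b ∷ []) = + toℕ r
f (suc (suc t)) (r ∷ rs) (b ∷ bs) = m (suc (suc t)) - a * d
  where
  -- here the "current" t of the paper is suc (suc t), so t-1 = suc t
  δ : ℤ
  δ = m (suc t) - f (suc t) rs bs
  d : ℤ
  d = + (2 *ℕ suc t ∸ (b ⊓ (2 *ℕ suc t)))
  s : ℤ
  s = + (1 ∸ toℕ r)
  a : ℤ
  a = + 2 * m (suc t) * s + δ * (d - + 1)

module Submission where

-- Write δ_t = m_t − f_t for the deficit of f_t from its claimed
-- maximum.  Unfolding the recursion, δ_1 = 1 − r_K and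
--     δ_t = a_t d_t = (2 m_{t-1} s_t + δ_{t-1} (d_t − 1)) d_t ,
-- so the deficits obey a recursion with natural-number coefficients and no
-- subtraction: δ_t = cost m_{t-1} s_t d_t δ_{t-1}, where cost is a polynomial
-- that is monotone in each argument.  Moreover, at the extreme arguments
-- s = 1, d = 2(t-1), δ = m_{t-1} it equals (2t-1)(2t-2) m_{t-1} = m_t.
-- Hence, by induction, 0 ≤ δ_t ≤ m_t, and so f_t = m_t ∸ δ_t in ℕ.
-- All claims then reduce to statements about δ_t: it is antitone in every
-- r_i and b_i (since s_t and d_t are), it vanishes when all r_i = 1
-- (then s_t = 0 and δ_{t-1} = 0), and it equals m_t when all r_i = b_i = 0
-- (then every argument of cost is extreme).

open import Defs
open import Data.Nat using (ℕ; suc; zero; _+_; _*_; _∸_; _⊓_; _!; z≤n)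
  renaming (_≤_ to _≤ℕ_)
open import Data.Nat.Properties
  using (≤-refl; ≤-trans; ≤-reflexive; +-mono-≤; *-mono-≤; ∸-monoˡ-≤; ∸-monoʳ-≤;
         m∸n≤m; n∸n≡0; *-zeroʳ; *-suc; ⊓-monoˡ-≤)
open import Data.Nat.Solver using (module +-*-Solver)
open import Data.Fin using (Fin; toℕ) renaming (zero to f0; suc to fs)
open import Data.Vec using (Vec; replicate; _[_]≔_; _∷_; [])
open import Data.Integer using (+_; +≤+) renaming (_≤_ to _≤ℤ_)
import Data.Integer as ℤ
import Data.Integer.Properties as ℤP
open import Data.Integer.Tactic.RingSolver using (solve-∀)
open import Data.Product using (_×_; _,_)
open import Relation.Binary.PropositionalEquality
  using (_≡_; refl; sym; trans; cong; cong₂)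
open Relation.Binary.PropositionalEquality.≡-Reasoning

-- The natural number m_t = (2t-1)!, so that  m t = + mℕ t  definitionally.
mℕ : ℕ → ℕ
mℕ t = (2 * t ∸ 1) !

mℕ-step : ∀ k → mℕ (suc (suc k)) ≡ suc (2 * suc k) * (2 * suc k * mℕ (suc k))
mℕ-step k = cong _! (cong (_∸ 1) (*-suc 2 (suc k)))

-- The product a_t d_t as a polynomial in m_{t-1}, s_t, d_t and δ_{t-1}.
cost : (M S D δ : ℕ) → ℕ
cost M S D δ = (2 * M * S + δ * (D ∸ 1)) * D

cost-mono : ∀ M {S S′ D D′ δ δ′} → S ≤ℕ S′ → D ≤ℕ D′ → δ ≤ℕ δ′ →
            cost M S D δ ≤ℕ cost M S′ D′ δ′
cost-mono M S≤ D≤ δ≤ =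
  *-mono-≤ (+-mono-≤ (*-mono-≤ (≤-refl {2 * M}) S≤) (*-mono-≤ δ≤ (∸-monoˡ-≤ 1 D≤))) D≤

cost-top : ∀ M x → cost M 1 (suc x) M ≡ suc (suc x) * (suc x * M)
cost-top M x = solve 2 (λ M x → (con 2 :* M :* con 1 :+ M :* x) :* (con 1 :+ x)
                                := (con 2 :+ x) :* ((con 1 :+ x) :* M)) refl M x
  where open +-*-Solver

cost-top-is-m : ∀ k → cost (mℕ (suc k)) 1 (2 * suc k) (mℕ (suc k)) ≡ mℕ (suc (suc k))
cost-top-is-m k = trans (cost-top (mℕ (suc k)) (2 * suc k ∸ 1)) (sym (mℕ-step k))

cost-zero : ∀ M D → cost M 0 D 0 ≡ 0
cost-zero M D rewrite *-zeroʳ (2 * M) = refl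

cost-ℤ : ∀ M S D δ →
  (+ 2 ℤ.* + M ℤ.* + S ℤ.+ + δ ℤ.* (+ D ℤ.- + 1)) ℤ.* + D ≡ + cost M S D δ
cost-ℤ M S zero δ = trans (ℤP.*-zeroʳ (+ 2 ℤ.* + M ℤ.* + S ℤ.+ + δ ℤ.* (+ 0 ℤ.- + 1)))
                          (cong +_ (sym (*-zeroʳ (2 * M * S + δ * 0))))
cost-ℤ M S (suc e) δ = sym (begin
  + ((2 * M * S + δ * e) * suc e)           ≡⟨ ℤP.pos-* (2 * M * S + δ * e) (suc e) ⟩
  + (2 * M * S + δ * e) ℤ.* + suc e         ≡⟨ cong (ℤ._* + suc e) (ℤP.pos-+ (2 * M * S) (δ * e)) ⟩
  (+ (2 * M * S) ℤ.+ + (δ * e)) ℤ.* + suc e ≡⟨ cong (ℤ._* + suc e)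
                                                 (cong₂ ℤ._+_ (trans (ℤP.pos-* (2 * M) S)
                                                                     (cong (ℤ._* + S) (ℤP.pos-* 2 M)))
                                                              (ℤP.pos-* δ e)) ⟩
  (+ 2 ℤ.* + M ℤ.* + S ℤ.+ + δ ℤ.* + e) ℤ.* + suc e ∎)

dℕ : ℕ → ℕ → ℕ
dℕ k b = 2 * suc k ∸ (b ⊓ (2 * suc k))

-- The deficit δ_t = m_t − f_t, computed in ℕ (t = k+1).
deficit : (k : ℕ) → Vec (Fin 2) (suc k) → Vec ℕ (suc k) → ℕ
deficit zero    (r ∷ [])  (b ∷ [])  = 1 ∸ toℕ r
deficit (suc k) (r ∷ rs) (b ∷ bs) = cost (mℕ (suc k)) (1 ∸ toℕ r) (dℕ k b) (deficit k rs bs)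

-- The deficit never exceeds m_t: all arguments of cost are at most their extremes.
deficit≤m : ∀ k rs bs → deficit k rs bs ≤ℕ mℕ (suc k)
deficit≤m zero    (r ∷ [])  (b ∷ [])  = m∸n≤m 1 (toℕ r)
deficit≤m (suc k) (r ∷ rs) (b ∷ bs) = ≤-trans
  (cost-mono (mℕ (suc k)) (m∸n≤m 1 (toℕ r)) (m∸n≤m (2 * suc k) (b ⊓ (2 * suc k)))
             (deficit≤m k rs bs))
  (≤-reflexive (cost-top-is-m k))

deficit-antitone-r : ∀ k rs bs (j : Fin (suc k)) (x y : Fin 2) → toℕ x ≤ℕ toℕ y →
  deficit k (rs [ j ]≔ y) bs ≤ℕ deficit k (rs [ j ]≔ x) bs
deficit-antitone-r zero    (r ∷ [])  (b ∷ [])  f0 x y x≤y = ∸-monoʳ-≤ 1 x≤y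
deficit-antitone-r (suc k) (r ∷ rs) (b ∷ bs) f0 x y x≤y =
  cost-mono (mℕ (suc k)) (∸-monoʳ-≤ 1 x≤y) (≤-refl {dℕ k b}) (≤-refl {deficit k rs bs})
deficit-antitone-r (suc k) (r ∷ rs) (b ∷ bs) (fs j) x y x≤y =
  cost-mono (mℕ (suc k)) ≤-refl ≤-refl (deficit-antitone-r k rs bs j x y x≤y)

deficit-antitone-b : ∀ k rs bs (j : Fin (suc k)) (x y : ℕ) → x ≤ℕ y →
  deficit k rs (bs [ j ]≔ y) ≤ℕ deficit k rs (bs [ j ]≔ x)
deficit-antitone-b zero    (r ∷ [])  (b ∷ [])  f0 x y x≤y = ≤-refl
deficit-antitone-b (suc k) (r ∷ rs) (b ∷ bs) f0 x y x≤y =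
  cost-mono (mℕ (suc k)) (≤-refl {1 ∸ toℕ r}) (∸-monoʳ-≤ (2 * suc k) (⊓-monoˡ-≤ (2 * suc k) x≤y))
            (≤-refl {deficit k rs bs})
deficit-antitone-b (suc k) (r ∷ rs) (b ∷ bs) (fs j) x y x≤y =
  cost-mono (mℕ (suc k)) ≤-refl ≤-refl (deficit-antitone-b k rs bs j x y x≤y)

deficit-ones : ∀ k bs → deficit k (replicate (suc k) (fs f0)) bs ≡ 0
deficit-ones zero    (b ∷ [])  = refl
deficit-ones (suc k) (b ∷ bs) rewrite deficit-ones k bs = cost-zero (mℕ (suc k)) (dℕ k b)

deficit-zeros : ∀ k → deficit k (replicate (suc k) f0) (replicate (suc k) 0) ≡ mℕ (suc k)
deficit-zeros zero = refl
deficit-zeros (suc k) rewrite deficit-zeros k = cost-top-is-m k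

-- Subtracting a difference from its minuend recovers the subtrahend; this is
-- how δ_{t-1} = m_{t-1} − f_{t-1} is recognised as the deficit.
minus-minus : ∀ (a b : ℤ.ℤ) → a ℤ.- (a ℤ.- b) ≡ b
minus-minus = solve-∀

-- f_t = m_t − δ_t in ℤ: the recursion for f is the recursion for the deficit.
f≡m-deficit : ∀ k rs bs → f (suc k) rs bs ≡ m (suc k) ℤ.- + deficit k rs bs
f≡m-deficit zero (f0 ∷ [])      (b ∷ []) = refl
f≡m-deficit zero (fs f0 ∷ []) (b ∷ []) = refl
f≡m-deficit (suc k) (r ∷ rs) (b ∷ bs) = begin
  f (suc (suc k)) (r ∷ rs) (b ∷ bs)
    ≡⟨ cong (λ δ → M′ ℤ.- (+ 2 ℤ.* M ℤ.* S ℤ.+ δ ℤ.* (D ℤ.- + 1)) ℤ.* D) δ≡deficit ⟩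
  M′ ℤ.- (+ 2 ℤ.* M ℤ.* S ℤ.+ + deficit k rs bs ℤ.* (D ℤ.- + 1)) ℤ.* D
    ≡⟨ cong (λ z → M′ ℤ.- z) (cost-ℤ (mℕ (suc k)) (1 ∸ toℕ r) (dℕ k b) (deficit k rs bs)) ⟩
  M′ ℤ.- + deficit (suc k) (r ∷ rs) (b ∷ bs) ∎
  where
  M′ = m (suc (suc k))
  M = m (suc k)
  S = + (1 ∸ toℕ r)
  D = + dℕ k b
  δ≡deficit : M ℤ.- f (suc k) rs bs ≡ + deficit k rs bs
  δ≡deficit = trans (cong (λ z → M ℤ.- z) (f≡m-deficit k rs bs)) (minus-minus M (+ deficit k rs bs))

-- Since δ_t ≤ m_t, the value f_t is the truncated difference m_t ∸ δ_t in ℕ.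
f≡m∸deficit : ∀ k rs bs → f (suc k) rs bs ≡ + (mℕ (suc k) ∸ deficit k rs bs)
f≡m∸deficit k rs bs = begin
  f (suc k) rs bs                           ≡⟨ f≡m-deficit k rs bs ⟩
  + mℕ (suc k) ℤ.- + deficit k rs bs        ≡⟨ ℤP.[+m]-[+n]≡m⊖n (mℕ (suc k)) (deficit k rs bs) ⟩
  mℕ (suc k) ℤ.⊖ deficit k rs bs            ≡⟨ ℤP.⊖-≥ (deficit≤m k rs bs) ⟩
  + (mℕ (suc k) ∸ deficit k rs bs)          ∎

f-mono-deficit : ∀ k {rs rs′ bs bs′} → deficit k rs′ bs′ ≤ℕ deficit k rs bs →
                 f (suc k) rs bs ≤ℤ f (suc k) rs′ bs′
f-mono-deficit k {rs} {rs′} {bs} {bs′} δ′≤δ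
  rewrite f≡m∸deficit k rs bs | f≡m∸deficit k rs′ bs′ = +≤+ (∸-monoʳ-≤ (mℕ (suc k)) δ′≤δ)

f≤m : ∀ k rs bs → f (suc k) rs bs ≤ℤ m (suc k)
f≤m k rs bs rewrite f≡m∸deficit k rs bs = +≤+ (m∸n≤m (mℕ (suc k)) (deficit k rs bs))

0≤f : ∀ k rs bs → + 0 ≤ℤ f (suc k) rs bs
0≤f k rs bs rewrite f≡m∸deficit k rs bs = +≤+ z≤n

f-ones : ∀ k bs → f (suc k) (replicate (suc k) (fs f0)) bs ≡ m (suc k)
f-ones k bs = trans (f≡m∸deficit k (replicate (suc k) (fs f0)) bs)
                    (cong (λ δ → + (mℕ (suc k) ∸ δ)) (deficit-ones k bs))

f-zeros : ∀ k → f (suc k) (replicate (suc k) f0) (replicate (suc k) 0) ≡ + 0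
f-zeros k = begin
  f (suc k) (replicate (suc k) f0) (replicate (suc k) 0)
    ≡⟨ f≡m∸deficit k (replicate (suc k) f0) (replicate (suc k) 0) ⟩
  + (mℕ (suc k) ∸ deficit k (replicate (suc k) f0) (replicate (suc k) 0))
    ≡⟨ cong (λ δ → + (mℕ (suc k) ∸ δ)) (deficit-zeros k) ⟩
  + (mℕ (suc k) ∸ mℕ (suc k))
    ≡⟨ cong +_ (n∸n≡0 (mℕ (suc k))) ⟩
  + 0 ∎

-- The parameter K only bounds the range of t; each f_t is analysed by the
-- deficit lemmas with t = k+1.
lemma3p4 : (K : ℕ) → 1 ≤ℕ K → (t : ℕ) → 1 ≤ℕ t → t ≤ℕ K →
    (((rs : Vec (Fin 2) t) (bs : Vec ℕ t) (j : Fin t) (x y : Fin 2) →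
    toℕ x ≤ℕ toℕ y → f t (rs [ j ]≔ x) bs ≤ℤ f t (rs [ j ]≔ y) bs)
    × ((rs : Vec (Fin 2) t) (bs : Vec ℕ t) (j : Fin t) (x y : ℕ) →
    x ≤ℕ y → f t rs (bs [ j ]≔ x) ≤ℤ f t rs (bs [ j ]≔ y)))
    × (((rs : Vec (Fin 2) t) (bs : Vec ℕ t) → f t rs bs ≤ℤ m t)
    × ((bs : Vec ℕ t) → f t (replicate t (fs f0)) bs ≡ m t))
    × (((rs : Vec (Fin 2) t) (bs : Vec ℕ t) → + 0 ≤ℤ f t rs bs)
    × (f t (replicate t f0) (replicate t 0) ≡ + 0))
lemma3p4 _ _ (suc k) _ _ =
  ( ( (λ rs bs j x y x≤y → f-mono-deficit k (deficit-antitone-r k rs bs j x y x≤y))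
    , (λ rs bs j x y x≤y → f-mono-deficit k (deficit-antitone-b k rs bs j x y x≤y)) )
  , (f≤m k , f-ones k)
  , (0≤f k , f-zeros k) )
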